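{- The supremum of the upper densities of all subsets of $\mathbb{Z}[i]$ which contain no $3$-term geometric progression with non-unit ratio in $\mathbb{Z}[i]$ is at least $0.844662$.
   Context: A $3$-term geometric progression with non-unit ratio is a set $\{n,nr,nr^2\}$ with $n\in\mathbb{Z}[i]$ nonzero and $r\in\mathbb{Z}[i]$ nonzero and not a unit. The upper density of $A\subseteq\mathbb{Z}[i]$ is $\limsup_{n\to\infty}|A\cap I_n|/|I_n|$, where $I_n=\{m\in\mathbb{Z}[i]:N(m)\le n\}$ and $N(a+bi)=a^2+b^2$. -}

module Defs where

open import Data.Bool using (Bool; true; false; _∧_)
open import Data.Nat as ℕ using (ℕ; zero; suc; _≤ᵇ_)
open import Data.Integer as ℤ using (ℤ; +_; -[1+_]; ∣_∣)
open import Data.List using (List; []; _∷_; map; concatMap; filter; length; upTo)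
open import Data.Product using (_×_; _,_; proj₁; proj₂)
open import Relation.Binary.PropositionalEquality using (_≡_; _≢_)
open import Relation.Nullary.Decidable using (T?)
open import Data.Bool using (T)
open import Data.Empty using (⊥)

-- Gaussian integers ℤ[i], a + b i represented as the pair (a , b).
ℤ[i] : Set
ℤ[i] = ℤ × ℤ

0ᵍ : ℤ[i]
0ᵍ = (+ 0 , + 0)

-- multiplication: (a + bi)(c + di) = (ac - bd) + (ad + bc) i
_*ᵍ_ : ℤ[i] → ℤ[i] → ℤ[i]
(a , b) *ᵍ (c , d) = (a ℤ.* c ℤ.- b ℤ.* d , a ℤ.* d ℤ.+ b ℤ.* c)

N : ℤ[i] → ℕ
N (a , b) = ∣ a ∣ ℕ.* ∣ a ∣ ℕ.+ ∣ b ∣ ℕ.* ∣ b ∣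

-- units of ℤ[i] are exactly the elements of norm 1
IsUnit : ℤ[i] → Set
IsUnit r = N r ≡ 1

Subset : Set
Subset = ℤ[i] → Bool

NoGP3 : Subset → Set
NoGP3 A = ∀ (n r : ℤ[i]) → n ≢ 0ᵍ → r ≢ 0ᵍ → ¬U r →
          A n ≡ true → A (n *ᵍ r) ≡ true → A ((n *ᵍ r) *ᵍ r) ≡ true → ⊥
  where
  ¬U : ℤ[i] → Set
  ¬U r = IsUnit r → ⊥

range : ℕ → List ℤ
range k = map (λ i → + i) (upTo (suc k)) Data.List.++ map (λ i → -[1+ i ]) (upTo k)

box : ℕ → List ℤ[i]
box k = concatMap (λ a → map (λ b → (a , b)) (range k)) (range k)

I : ℕ → List ℤ[i]
I n = filter (λ z → T? (N z ≤ᵇ n)) (box n)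

countIn : Subset → ℕ → ℕ
countIn A n = length (filter (λ z → T? (A z)) (I n))

-- |A ∩ I_n| / |I_n| ≥ p/q - 1/(k+1), cleared of denominators (q > 0 assumed by use):
--   |A ∩ I_n| · q · (k+1) + q · |I_n| ≥ p · (k+1) · |I_n|
RatioAtLeast : Subset → ℕ → (p q k : ℕ) → Set
RatioAtLeast A n p q k =
  p ℕ.* suc k ℕ.* length (I n) ℕ.≤ countIn A n ℕ.* q ℕ.* suc k ℕ.+ q ℕ.* length (I n)

-- upper density of A is ≥ p/q - 1/(k+1) ... (limsup ≥ x  iff  ∀ N ∃ n ≥ N, ratio ≥ x - ε for all ε)
-- The supremum over NoGP3 sets of the upper density is ≥ p/q iff
--   ∀ k, ∃ A NoGP3, ∀ N, ∃ n ≥ N, ratio_n(A) ≥ p/q - 1/(k+1).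

module Submission where

-- A consists of the p whose norm lies in a fixed pattern of eight annuli
-- (a·z)² < N p ≤ (b·z)², repeated at a lacunary sequence of scales z.  Since the
-- norm is multiplicative, a progression yields norms x, x·t, x·t² with t = N r ≥ 2.
-- Within one scale these are excluded by a finite computation for t < 13² and by
-- the narrow span of the pattern for larger t; across scales by lacunarity.
-- For the density we avoid the asymptotics of lattice points in discs: the count
-- L r of points in the disc of radius r satisfies the elementary scaling bounds
-- k²·L z ≤ L (k(z + 2)) and L (k·z) ≤ k²·L (z + 2), and, growing polynomially, it has
-- arbitrarily large radii y with L (y + 4) ≤ (1 + 1/D)·L y.  At such radii the
-- annuli carry the proportion (Σ b² − Σ a²)/rOut² of the disc, up to 1/(k + 1).

open import Defs
open import Data.Bool using (true)
open import Data.Bool.Properties using (T-≡)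
open import Data.Empty using (⊥; ⊥-elim)
open import Data.Integer as ℤ using (ℤ; +_; -[1+_]; ∣_∣)
import Data.Integer.Properties as ℤP
open import Data.Integer.DivMod using (_/ℕ_; _%ℕ_; a≡a%ℕn+[a/ℕn]*n; n%ℕd<d)
import Data.Integer.Tactic.RingSolver as ℤSolver
open import Data.List using (List; []; _∷_; _++_; length; map; filter; concatMap; upTo; cartesianProduct; cartesianProductWith)
open import Data.List.Properties using (length-++; length-map; length-upTo; length-filter)
open import Data.List.Membership.Propositional using (_∈_; find; lose)
open import Data.List.Membership.Propositional.Properties
open import Data.List.Relation.Unary.All as All using (All; []; _∷_; all?)
import Data.List.Relation.Unary.All.Properties as AllP
open import Data.List.Relation.Unary.AllPairs as AllPairs using (AllPairs; []; _∷_; allPairs?)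
import Data.List.Relation.Unary.AllPairs.Properties as AllPairsP
open import Data.List.Relation.Unary.Any using (Any; any?; here; there)
open import Data.List.Relation.Unary.Unique.Propositional using (Unique)
import Data.List.Relation.Unary.Unique.Propositional.Properties as Unique
open import Data.Nat using (ℕ; zero; suc; _+_; _*_; _∸_; _^_; _≤_; _<_; z≤n; s≤s; _≤ᵇ_; _≤?_; _<?_; NonZero; >-nonZero)
open import Data.Nat.ListAction using (sum)
open import Data.Nat.Properties
open import Algebra.Properties.CommutativeSemigroup *-commutativeSemigroup using (xy∙z≈xz∙y)
open import Data.Nat.Tactic.RingSolver using (solve-∀)
open import Data.Product using (Σ; _×_; _,_; proj₁; proj₂)
open import Data.Sum using (_⊎_; inj₁; inj₂)
open import Function.Bundles using (Equivalence)
open import Relation.Binary.PropositionalEquality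
open import Relation.Nullary using (Dec; ¬_; yes; no)
open import Relation.Nullary.Decidable using (T?; isYes; toWitness; fromWitness; from-yes; _×-dec_; _⊎-dec_; _→-dec_)

∈-delete : ∀ {A : Set} {v w : A} (us vs : List A) → v ∈ us ++ w ∷ vs → v ≢ w → v ∈ us ++ vs
∈-delete []       vs (here v≡w) v≢w = ⊥-elim (v≢w v≡w)
∈-delete []       vs (there v∈) _   = v∈
∈-delete (u ∷ us) vs (here v≡u) _   = here v≡u
∈-delete (u ∷ us) vs (there v∈) v≢w = there (∈-delete us vs v∈ v≢w)

length-insert : ∀ {A : Set} (us : List A) w vs → length (us ++ w ∷ vs) ≡ suc (length (us ++ vs))
length-insert us w vs = begin
  length (us ++ w ∷ vs)        ≡⟨ length-++ us ⟩
  length us + suc (length vs)  ≡⟨ +-suc (length us) (length vs) ⟩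
  suc (length us + length vs)  ≡⟨ cong suc (sym (length-++ us)) ⟩
  suc (length (us ++ vs))      ∎
  where open ≡-Reasoning

length-≤-injection : ∀ {A B : Set} (f : A → B) {xs : List A} {ys : List B} → Unique xs →
  (∀ {x} → x ∈ xs → f x ∈ ys) → (∀ {x y} → x ∈ xs → y ∈ xs → f x ≡ f y → x ≡ y) →
  length xs ≤ length ys
length-≤-injection f {[]}     _              _    _   = z≤n
length-≤-injection f {x ∷ xs} (x∉xs ∷ uniq) maps inj with ∈-∃++ (maps (here refl))
... | us , vs , refl = ≤-trans (s≤s (length-≤-injection f uniq maps′ inj′)) (≤-reflexive (sym (length-insert us (f x) vs)))
  where
  maps′ : ∀ {y} → y ∈ xs → f y ∈ us ++ vs
  maps′ y∈ = ∈-delete us vs (maps (there y∈)) (λ fy≡fx → All.lookup x∉xs y∈ (inj (here refl) (there y∈) (sym fy≡fx)))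
  inj′ : ∀ {y y′} → y ∈ xs → y′ ∈ xs → f y ≡ f y′ → y ≡ y′
  inj′ y∈ y′∈ = inj (there y∈) (there y′∈)

length-≤-subset : ∀ {A : Set} {xs ys : List A} → Unique xs → (∀ {x} → x ∈ xs → x ∈ ys) → length xs ≤ length ys
length-≤-subset uniq sub = length-≤-injection (λ x → x) uniq sub (λ _ _ eq → eq)

length-cartesianProductWith : ∀ {A B C : Set} (f : A → B → C) xs ys →
  length (cartesianProductWith f xs ys) ≡ length xs * length ys
length-cartesianProductWith f []       ys = refl
length-cartesianProductWith f (x ∷ xs) ys =
  trans (length-++ (map (f x) ys)) (cong₂ _+_ (length-map (f x) ys) (length-cartesianProductWith f xs ys))

-- Squares of natural numbers; N (a , b) is definitionally sq ∣ a ∣ + sq ∣ b ∣.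
sq : ℕ → ℕ
sq x = x * x

n≤sq : ∀ x → x ≤ sq x
n≤sq zero    = z≤n
n≤sq (suc x) = m≤m*n (suc x) (suc x)

sq-mono : ∀ {x y} → x ≤ y → sq x ≤ sq y
sq-mono x≤y = *-mono-≤ x≤y x≤y

sq-≤-inv : ∀ {x y} → sq x ≤ sq y → x ≤ y
sq-≤-inv {x} {y} sx≤sy with x ≤? y
... | yes x≤y = x≤y
... | no  x≰y = ⊥-elim (<⇒≱ (*-mono-< (≰⇒> x≰y) (≰⇒> x≰y)) sx≤sy)

sq-* : ∀ k x → sq (k * x) ≡ sq k * sq x
sq-* = identity
  where
  identity : ∀ k x → k * x * (k * x) ≡ k * k * (x * x)
  identity = solve-∀

scaled-norm : ∀ k X Y → sq (k * X) + sq (k * Y) ≡ sq k * (sq X + sq Y)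
scaled-norm = identity
  where
  identity : ∀ k X Y → k * X * (k * X) + k * Y * (k * Y) ≡ k * k * (X * X + Y * Y)
  identity = solve-∀

sq-abs : ∀ (a : ℤ) → + sq ∣ a ∣ ≡ a ℤ.* a
sq-abs a with ℤP.+∣i∣≡i⊎+∣i∣≡-i a
... | inj₁ eq = trans (ℤP.pos-* ∣ a ∣ ∣ a ∣) (cong₂ ℤ._*_ eq eq)
... | inj₂ eq = trans (ℤP.pos-* ∣ a ∣ ∣ a ∣) (trans (cong₂ ℤ._*_ eq eq) (neg-sq a))
  where
  neg-sq : ∀ a → ℤ.- a ℤ.* ℤ.- a ≡ a ℤ.* a
  neg-sq = ℤSolver.solve-∀

-- The norm a² + b² computed in ℤ, where the ring solver applies.
normℤ : ℤ[i] → ℤ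
normℤ (a , b) = a ℤ.* a ℤ.+ b ℤ.* b

N≡normℤ : ∀ p → + N p ≡ normℤ p
N≡normℤ (a , b) = trans (ℤP.pos-+ (sq ∣ a ∣) (sq ∣ b ∣)) (cong₂ ℤ._+_ (sq-abs a) (sq-abs b))

N-* : ∀ p q → N (p *ᵍ q) ≡ N p * N q
N-* (a , b) (c , d) = ℤP.+-injective (begin
  + N ((a , b) *ᵍ (c , d))             ≡⟨ N≡normℤ ((a , b) *ᵍ (c , d)) ⟩
  normℤ ((a , b) *ᵍ (c , d))           ≡⟨ identity a b c d ⟩
  normℤ (a , b) ℤ.* normℤ (c , d)      ≡⟨ sym (cong₂ ℤ._*_ (N≡normℤ (a , b)) (N≡normℤ (c , d))) ⟩
  + N (a , b) ℤ.* + N (c , d)          ≡⟨ sym (ℤP.pos-* (N (a , b)) (N (c , d))) ⟩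
  + (N (a , b) * N (c , d))            ∎)
  where
  open ≡-Reasoning
  identity : ∀ a b c d → (a ℤ.* c ℤ.- b ℤ.* d) ℤ.* (a ℤ.* c ℤ.- b ℤ.* d) ℤ.+ (a ℤ.* d ℤ.+ b ℤ.* c) ℤ.* (a ℤ.* d ℤ.+ b ℤ.* c)
                         ≡ (a ℤ.* a ℤ.+ b ℤ.* b) ℤ.* (c ℤ.* c ℤ.+ d ℤ.* d)
  identity = ℤSolver.solve-∀

sq≡0 : ∀ x → sq x ≡ 0 → x ≡ 0
sq≡0 zero _ = refl

N≡0⇒≡0 : ∀ p → N p ≡ 0 → p ≡ 0ᵍ
N≡0⇒≡0 (a , b) eq = cong₂ _,_
  (ℤP.∣i∣≡0⇒i≡0 (sq≡0 ∣ a ∣ (m+n≡0⇒m≡0 (sq ∣ a ∣) eq)))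
  (ℤP.∣i∣≡0⇒i≡0 (sq≡0 ∣ b ∣ (m+n≡0⇒n≡0 (sq ∣ a ∣) eq)))

N-nonzero : ∀ p → p ≢ 0ᵍ → 1 ≤ N p
N-nonzero p p≢0 with N p in eq
... | zero  = ⊥-elim (p≢0 (N≡0⇒≡0 p eq))
... | suc _ = s≤s z≤n

N-nonunit : ∀ r → r ≢ 0ᵍ → ¬ IsUnit r → 2 ≤ N r
N-nonunit r r≢0 r-nonunit with N r in eq
... | zero        = ⊥-elim (r≢0 (N≡0⇒≡0 r eq))
... | suc zero    = ⊥-elim (r-nonunit refl)
... | suc (suc _) = s≤s (s≤s z≤n)

∈-range : ∀ {k} a → ∣ a ∣ ≤ k → a ∈ range k
∈-range {k} (+ i)    i≤k = ∈-++⁺ˡ (∈-map⁺ +_ (∈-upTo⁺ (s≤s i≤k)))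
∈-range {k} -[1+ i ] i<k = ∈-++⁺ʳ (map +_ (upTo (suc k))) (∈-map⁺ -[1+_] (∈-upTo⁺ i<k))

range-unique : ∀ k → Unique (range k)
range-unique k = Unique.++⁺ (Unique.map⁺ ℤP.+-injective (Unique.upTo⁺ (suc k)))
                            (Unique.map⁺ ℤP.-[1+-injective (Unique.upTo⁺ k)) signs-differ
  where
  signs-differ : ∀ {v} → v ∈ map +_ (upTo (suc k)) × v ∈ map -[1+_] (upTo k) → ⊥
  signs-differ (v∈₊ , v∈₋) with ∈-map⁻ +_ v∈₊ | ∈-map⁻ -[1+_] v∈₋
  ... | _ , _ , refl | _ , _ , ()

box≡cartesianProduct : ∀ k → box k ≡ cartesianProduct (range k) (range k)
box≡cartesianProduct k = go (range k)
  where
  go : ∀ xs → concatMap (λ a → map (a ,_) (range k)) xs ≡ cartesianProduct xs (range k)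
  go []       = refl
  go (x ∷ xs) = cong (map (x ,_) (range k) ++_) (go xs)

∈-I⁺ : ∀ {n} p → N p ≤ n → p ∈ I n
∈-I⁺ {n} (a , b) Np≤n = ∈-filter⁺ (λ z → T? (N z ≤ᵇ n)) {xs = box n}
  (subst ((a , b) ∈_) (sym (box≡cartesianProduct n))
    (∈-cartesianProduct⁺ (∈-range a (≤-trans (n≤sq ∣ a ∣) (≤-trans (m≤m+n _ _) Np≤n)))
                         (∈-range b (≤-trans (n≤sq ∣ b ∣) (≤-trans (m≤n+m _ _) Np≤n)))))
  (≤⇒≤ᵇ Np≤n)

∈-I⁻ : ∀ {n p} → p ∈ I n → N p ≤ n
∈-I⁻ {n} {p} p∈ = ≤ᵇ⇒≤ (N p) n (proj₂ (∈-filter⁻ (λ z → T? (N z ≤ᵇ n)) {xs = box n} p∈))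

I-unique : ∀ n → Unique (I n)
I-unique n = Unique.filter⁺ (λ z → T? (N z ≤ᵇ n)) {xs = box n}
  (subst Unique (sym (box≡cartesianProduct n)) (Unique.cartesianProduct⁺ (range-unique n) (range-unique n)))

length-I≤ : ∀ n → length (I n) ≤ sq (suc (n + n))
length-I≤ n = begin
  length (I n)                                  ≤⟨ length-filter (λ z → T? (N z ≤ᵇ n)) (box n) ⟩
  length (box n)                                ≡⟨ cong length (box≡cartesianProduct n) ⟩
  length (cartesianProduct (range n) (range n)) ≡⟨ length-cartesianProductWith _,_ (range n) (range n) ⟩
  length (range n) * length (range n)           ≡⟨ cong sq (length-range n) ⟩
  sq (suc (n + n))                              ∎
  where
  open ≤-Reasoning
  length-range : ∀ n → length (range n) ≡ suc (n + n)
  length-range n = trans (length-++ (map +_ (upTo (suc n))))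
    (cong₂ _+_ (trans (length-map +_ (upTo (suc n))) (length-upTo (suc n)))
               (trans (length-map -[1+_] (upTo n)) (length-upTo n)))

L : ℕ → ℕ
L r = length (I (sq r))

L-mono : ∀ {r s} → r ≤ s → L r ≤ L s
L-mono {r} r≤s = length-≤-subset (I-unique (sq r)) (λ {p} p∈ → ∈-I⁺ p (≤-trans (∈-I⁻ p∈) (*-mono-≤ r≤s r≤s)))

L-positive : ∀ r → 1 ≤ L r
L-positive r = length-≤-subset {xs = 0ᵍ ∷ []} ([] ∷ []) (λ { (here refl) → ∈-I⁺ {sq r} 0ᵍ z≤n })

-- Polynomial growth: the disc of radius s lies in the box [-s², s²]².
L-quartic : ∀ s → 1 ≤ s → L s ≤ 9 * sq (sq s)
L-quartic s 1≤s = begin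
  L s                          ≤⟨ length-I≤ (sq s) ⟩
  sq (suc (sq s + sq s))       ≤⟨ *-mono-≤ three-sq three-sq ⟩
  sq (3 * sq s)                ≡⟨ nine (sq s) ⟩
  9 * sq (sq s)                ∎
  where
  open ≤-Reasoning
  three-sq : suc (sq s + sq s) ≤ 3 * sq s
  three-sq = ≤-trans (+-monoˡ-≤ (sq s + sq s) (*-mono-≤ 1≤s 1≤s)) (≤-reflexive (triple (sq s)))
    where
    triple : ∀ x → x + (x + x) ≡ 3 * x
    triple = solve-∀
  nine : ∀ x → 3 * x * (3 * x) ≡ 9 * (x * x)
  nine = solve-∀

disc-enlarge : ∀ k z X Y → sq X + sq Y ≤ sq (k * z) → sq (X + k) + sq (Y + k) ≤ sq (k * (z + 2))
disc-enlarge k z X Y inside = begin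
  sq (X + k) + sq (Y + k)                                   ≡⟨ expand X Y k ⟩
  (sq X + sq Y) + 2 * k * (X + Y) + 2 * sq k                ≤⟨ +-monoˡ-≤ (2 * sq k) (+-mono-≤ inside (*-monoʳ-≤ (2 * k) (+-mono-≤ X≤kz Y≤kz))) ⟩
  sq (k * z) + 2 * k * (k * z + k * z) + 2 * sq k           ≤⟨ m≤m+n _ (2 * sq k) ⟩
  sq (k * z) + 2 * k * (k * z + k * z) + 2 * sq k + 2 * sq k ≡⟨ collect k z ⟩
  sq (k * (z + 2))                                          ∎
  where
  open ≤-Reasoning
  X≤kz : X ≤ k * z
  X≤kz = sq-≤-inv (≤-trans (m≤m+n (sq X) (sq Y)) inside)
  Y≤kz : Y ≤ k * z
  Y≤kz = sq-≤-inv (≤-trans (m≤n+m (sq Y) (sq X)) inside)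
  expand : ∀ X Y k → (X + k) * (X + k) + (Y + k) * (Y + k) ≡ (X * X + Y * Y) + 2 * k * (X + Y) + 2 * (k * k)
  expand = solve-∀
  collect : ∀ k z → k * z * (k * z) + 2 * k * (k * z + k * z) + 2 * (k * k) + 2 * (k * k) ≡ k * (z + 2) * (k * (z + 2))
  collect = solve-∀

-- digits k lists the k² remainders {0,…,k-1}² of division by k in ℤ[i].
digits : ℕ → List ℤ[i]
digits k = cartesianProduct (map +_ (upTo k)) (map +_ (upTo k))

∈-digits⁺ : ∀ k {r s} → r < k → s < k → (+ r , + s) ∈ digits k
∈-digits⁺ k r<k s<k = ∈-cartesianProduct⁺ (∈-map⁺ +_ (∈-upTo⁺ r<k)) (∈-map⁺ +_ (∈-upTo⁺ s<k))

∈-digits⁻ : ∀ k {w} → w ∈ digits k → Σ ℕ λ r → Σ ℕ λ s → r < k × s < k × w ≡ (+ r , + s)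
∈-digits⁻ k {r , s} w∈ with ∈-cartesianProduct⁻ (map +_ (upTo k)) (map +_ (upTo k)) w∈
... | r∈ , s∈ with ∈-map⁻ +_ r∈ | ∈-map⁻ +_ s∈
... | r′ , r′∈ , refl | s′ , s′∈ , refl = r′ , s′ , ∈-upTo⁻ r′∈ , ∈-upTo⁻ s′∈ , refl

digits-unique : ∀ k → Unique (digits k)
digits-unique k = Unique.cartesianProduct⁺ naturals naturals
  where
  naturals : Unique (map +_ (upTo k))
  naturals = Unique.map⁺ ℤP.+-injective (Unique.upTo⁺ k)

length-digits : ∀ k → length (digits k) ≡ sq k
length-digits k = trans (length-cartesianProductWith _,_ (map +_ (upTo k)) (map +_ (upTo k)))
                        (cong sq (trans (length-map +_ (upTo k)) (length-upTo k)))

dilate : ℕ → ℤ[i] → ℤ[i] → ℤ[i]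
dilate k (a , b) (r , s) = (+ k ℤ.* a ℤ.+ r , + k ℤ.* b ℤ.+ s)

∣dilate∣≤ : ∀ k a r → r ≤ k → ∣ + k ℤ.* a ℤ.+ + r ∣ ≤ k * ∣ a ∣ + k
∣dilate∣≤ k a r r≤k = ≤-trans (ℤP.∣i+j∣≤∣i∣+∣j∣ (+ k ℤ.* a) (+ r)) (+-mono-≤ (≤-reflexive (ℤP.abs-* (+ k) a)) r≤k)

division : ∀ k .{{_ : NonZero k}} (a : ℤ) → + k ℤ.* (a /ℕ k) ℤ.+ + (a %ℕ k) ≡ a
division k a = sym (trans (a≡a%ℕn+[a/ℕn]*n a k) (reorder (+ (a %ℕ k)) (a /ℕ k) (+ k)))
  where
  reorder : ∀ r q k → r ℤ.+ q ℤ.* k ≡ k ℤ.* q ℤ.+ r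
  reorder = ℤSolver.solve-∀

∣quotient∣≤ : ∀ k .{{_ : NonZero k}} (a : ℤ) → k * ∣ a /ℕ k ∣ ≤ ∣ a ∣ + k
∣quotient∣≤ k a = begin
  k * ∣ q ∣                ≡⟨ sym (ℤP.abs-* (+ k) q) ⟩
  ∣ + k ℤ.* q ∣            ≡⟨ cong ∣_∣ kq≡a-r ⟩
  ∣ a ℤ.+ ℤ.- (+ r) ∣      ≤⟨ ℤP.∣i+j∣≤∣i∣+∣j∣ a (ℤ.- (+ r)) ⟩
  ∣ a ∣ + ∣ ℤ.- (+ r) ∣    ≡⟨ cong (_+_ ∣ a ∣) (ℤP.∣-i∣≡∣i∣ (+ r)) ⟩
  ∣ a ∣ + r                ≤⟨ +-monoʳ-≤ ∣ a ∣ (<⇒≤ (n%ℕd<d a k)) ⟩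
  ∣ a ∣ + k                ∎
  where
  open ≤-Reasoning
  q : ℤ
  q = a /ℕ k
  r : ℕ
  r = a %ℕ k
  move : ∀ (x y z : ℤ) → x ℤ.+ y ≡ z → x ≡ z ℤ.+ ℤ.- y
  move x y .(x ℤ.+ y) refl = cancel x y
    where
    cancel : ∀ x y → x ≡ x ℤ.+ y ℤ.+ ℤ.- y
    cancel = ℤSolver.solve-∀
  kq≡a-r : + k ℤ.* q ≡ a ℤ.+ ℤ.- (+ r)
  kq≡a-r = move (+ k ℤ.* q) (+ r) a (division k a)

remainder-unique : ∀ k (a a′ : ℤ) {r r′} → r < k → r′ < k →
  + k ℤ.* a ℤ.+ + r ≡ + k ℤ.* a′ ℤ.+ + r′ → a ≡ a′ × r ≡ r′
remainder-unique k a a′ {r} {r′} r<k r′<k eq = a≡a′ , r≡r′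
  where
  difference : ∀ (K a a′ r r′ : ℤ) → K ℤ.* a ℤ.+ r ≡ K ℤ.* a′ ℤ.+ r′ → K ℤ.* (a ℤ.- a′) ≡ r′ ℤ.- r
  difference K a a′ r r′ eq = begin
    K ℤ.* (a ℤ.- a′)                     ≡⟨ expand K a a′ r ⟩
    K ℤ.* a ℤ.+ r ℤ.- K ℤ.* a′ ℤ.- r     ≡⟨ cong (λ x → x ℤ.- K ℤ.* a′ ℤ.- r) eq ⟩
    K ℤ.* a′ ℤ.+ r′ ℤ.- K ℤ.* a′ ℤ.- r   ≡⟨ contract K a′ r′ r ⟩
    r′ ℤ.- r                             ∎
    where
    open ≡-Reasoning
    expand : ∀ K a a′ r → K ℤ.* (a ℤ.- a′) ≡ K ℤ.* a ℤ.+ r ℤ.- K ℤ.* a′ ℤ.- r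
    expand = ℤSolver.solve-∀
    contract : ∀ K a′ r′ r → K ℤ.* a′ ℤ.+ r′ ℤ.- K ℤ.* a′ ℤ.- r ≡ r′ ℤ.- r
    contract = ℤSolver.solve-∀
  k[a-a′]≡r′-r : + k ℤ.* (a ℤ.- a′) ≡ + r′ ℤ.- + r
  k[a-a′]≡r′-r = difference (+ k) a a′ (+ r) (+ r′) eq
  small : k * ∣ a ℤ.- a′ ∣ < k * 1
  small = begin-strict
    k * ∣ a ℤ.- a′ ∣        ≡⟨ sym (ℤP.abs-* (+ k) (a ℤ.- a′)) ⟩
    ∣ + k ℤ.* (a ℤ.- a′) ∣  ≡⟨ cong ∣_∣ (trans k[a-a′]≡r′-r (ℤP.m-n≡m⊖n r′ r)) ⟩
    ∣ r′ ℤ.⊖ r ∣            ≤⟨ ℤP.∣m⊝n∣≤m⊔n r′ r ⟩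
    r′ Data.Nat.⊔ r         <⟨ ⊔-lub r′<k r<k ⟩
    k                       ≡⟨ sym (*-identityʳ k) ⟩
    k * 1                   ∎
    where open ≤-Reasoning
  a≡a′ : a ≡ a′
  a≡a′ = ℤP.i-j≡0⇒i≡j a a′ (ℤP.∣i∣≡0⇒i≡0 (n<1⇒n≡0 (*-cancelˡ-< k _ _ small)))
  r≡r′ : r ≡ r′
  r≡r′ = sym (ℤP.+-injective (ℤP.i-j≡0⇒i≡j (+ r′) (+ r) (begin
    + r′ ℤ.- + r            ≡⟨ sym k[a-a′]≡r′-r ⟩
    + k ℤ.* (a ℤ.- a′)      ≡⟨ cong (λ x → + k ℤ.* (a ℤ.- x)) (sym a≡a′) ⟩
    + k ℤ.* (a ℤ.- a)       ≡⟨ vanish (+ k) a ⟩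
    + 0                     ∎)))
    where
    open ≡-Reasoning
    vanish : ∀ K a → K ℤ.* (a ℤ.- a) ≡ + 0
    vanish = ℤSolver.solve-∀

-- Lower scaling bound: the k² points k·p + w, with N p ≤ z² and w a digit,
-- are distinct and lie in the disc of radius k·(z + 2).
L-dilate-lower : ∀ k z → sq k * L z ≤ L (k * (z + 2))
L-dilate-lower k z = begin
  sq k * L z                                        ≡⟨ *-comm (sq k) (L z) ⟩
  L z * sq k                                        ≡⟨ sym (trans (length-cartesianProductWith _,_ (I (sq z)) (digits k)) (cong (L z *_) (length-digits k))) ⟩
  length (cartesianProduct (I (sq z)) (digits k))   ≤⟨ length-≤-injection (λ (p , w) → dilate k p w)
                                                         (Unique.cartesianProduct⁺ (I-unique (sq z)) (digits-unique k)) maps injective ⟩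
  L (k * (z + 2))                                   ∎
  where
  open ≤-Reasoning
  maps : ∀ {x} → x ∈ cartesianProduct (I (sq z)) (digits k) → dilate k (proj₁ x) (proj₂ x) ∈ I (sq (k * (z + 2)))
  maps {(m₁ , m₂) , w} x∈ with ∈-cartesianProduct⁻ (I (sq z)) (digits k) x∈
  ... | m∈ , w∈ with ∈-digits⁻ k w∈
  ... | r , s , r<k , s<k , refl = ∈-I⁺ (dilate k (m₁ , m₂) (+ r , + s)) (begin
    sq (∣ + k ℤ.* m₁ ℤ.+ + r ∣) + sq (∣ + k ℤ.* m₂ ℤ.+ + s ∣)
      ≤⟨ +-mono-≤ (*-mono-≤ (∣dilate∣≤ k m₁ r (<⇒≤ r<k)) (∣dilate∣≤ k m₁ r (<⇒≤ r<k)))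
                  (*-mono-≤ (∣dilate∣≤ k m₂ s (<⇒≤ s<k)) (∣dilate∣≤ k m₂ s (<⇒≤ s<k))) ⟩
    sq (k * ∣ m₁ ∣ + k) + sq (k * ∣ m₂ ∣ + k)
      ≤⟨ disc-enlarge k z (k * ∣ m₁ ∣) (k * ∣ m₂ ∣) (begin
           sq (k * ∣ m₁ ∣) + sq (k * ∣ m₂ ∣)  ≡⟨ scaled-norm k (∣ m₁ ∣) (∣ m₂ ∣) ⟩
           sq k * N (m₁ , m₂)                  ≤⟨ *-monoʳ-≤ (sq k) (∈-I⁻ m∈) ⟩
           sq k * sq z                         ≡⟨ sym (sq-* k z) ⟩
           sq (k * z)                          ∎) ⟩
    sq (k * (z + 2))                                         ∎)
  injective : ∀ {x y} → x ∈ cartesianProduct (I (sq z)) (digits k) → y ∈ cartesianProduct (I (sq z)) (digits k) →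
              dilate k (proj₁ x) (proj₂ x) ≡ dilate k (proj₁ y) (proj₂ y) → x ≡ y
  injective {(m₁ , m₂) , w} {(m₁′ , m₂′) , w′} x∈ y∈ eq
    with ∈-digits⁻ k (proj₂ (∈-cartesianProduct⁻ (I (sq z)) (digits k) x∈))
       | ∈-digits⁻ k (proj₂ (∈-cartesianProduct⁻ (I (sq z)) (digits k) y∈))
  ... | r , s , r<k , s<k , refl | r′ , s′ , r′<k , s′<k , refl
    with remainder-unique k m₁ m₁′ r<k r′<k (cong proj₁ eq) | remainder-unique k m₂ m₂′ s<k s′<k (cong proj₂ eq)
  ... | refl , refl | refl , refl = refl

-- Upper scaling bound: dividing by k maps the disc of radius k·z into the disc of
-- radius z + 2, and a point is recovered from its quotient and remainder.
L-dilate-upper : ∀ k z → 1 ≤ k → L (k * z) ≤ sq k * L (z + 2)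
L-dilate-upper k@(suc _) z _ = begin
  L (k * z)                                                        ≤⟨ length-≤-subset (I-unique (sq (k * z))) covered ⟩
  length (cartesianProductWith (dilate k) (I (sq (z + 2))) (digits k)) ≡⟨ length-cartesianProductWith (dilate k) (I (sq (z + 2))) (digits k) ⟩
  L (z + 2) * length (digits k)                                    ≡⟨ cong (L (z + 2) *_) (length-digits k) ⟩
  L (z + 2) * sq k                                                 ≡⟨ *-comm (L (z + 2)) (sq k) ⟩
  sq k * L (z + 2)                                                 ∎
  where
  open ≤-Reasoning
  covered : ∀ {p} → p ∈ I (sq (k * z)) → p ∈ cartesianProductWith (dilate k) (I (sq (z + 2))) (digits k)
  covered {a , b} p∈ = subst (_∈ cartesianProductWith (dilate k) (I (sq (z + 2))) (digits k))
    (cong₂ _,_ (division k a) (division k b))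
    (∈-cartesianProductWith⁺ (dilate k) (∈-I⁺ (a /ℕ k , b /ℕ k) quotient-in-disc) (∈-digits⁺ k (n%ℕd<d a k) (n%ℕd<d b k)))
    where
    u v : ℕ
    u = ∣ a /ℕ k ∣
    v = ∣ b /ℕ k ∣
    scaled : sq k * (sq u + sq v) ≤ sq k * sq (z + 2)
    scaled = begin
      sq k * (sq u + sq v)             ≡⟨ sym (scaled-norm k u v) ⟩
      sq (k * u) + sq (k * v)          ≤⟨ +-mono-≤ (*-mono-≤ (∣quotient∣≤ k a) (∣quotient∣≤ k a)) (*-mono-≤ (∣quotient∣≤ k b) (∣quotient∣≤ k b)) ⟩
      sq (∣ a ∣ + k) + sq (∣ b ∣ + k)  ≤⟨ disc-enlarge k z (∣ a ∣) (∣ b ∣) (∈-I⁻ p∈) ⟩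
      sq (k * (z + 2))                 ≡⟨ sq-* k (z + 2) ⟩
      sq k * sq (z + 2)                ∎
    quotient-in-disc : N (a /ℕ k , b /ℕ k) ≤ sq (z + 2)
    quotient-in-disc = *-cancelˡ-≤ (sq k) scaled

slow-step-or-growth : ∀ D m (g : ℕ → ℕ) →
  (Σ ℕ λ i → i < m × D * g (suc i) ≤ suc D * g i) ⊎ (suc D ^ m * g 0 ≤ D ^ m * g m)
slow-step-or-growth D zero    g = inj₂ ≤-refl
slow-step-or-growth D (suc m) g with D * g 1 ≤? suc D * g 0
... | yes slow = inj₁ (0 , s≤s z≤n , slow)
... | no  fast with slow-step-or-growth D m (λ i → g (suc i))
...   | inj₁ (i , i<m , slow) = inj₁ (suc i , s≤s i<m , slow)
...   | inj₂ growth = inj₂ (begin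
  suc D ^ suc m * g 0         ≡⟨ regroup (suc D) (suc D ^ m) (g 0) ⟩
  suc D ^ m * (suc D * g 0)   ≤⟨ *-monoʳ-≤ (suc D ^ m) (<⇒≤ (≰⇒> fast)) ⟩
  suc D ^ m * (D * g 1)       ≡⟨ swap (suc D ^ m) D (g 1) ⟩
  D * (suc D ^ m * g 1)       ≤⟨ *-monoʳ-≤ D growth ⟩
  D * (D ^ m * g (suc m))     ≡⟨ sym (*-assoc D (D ^ m) (g (suc m))) ⟩
  D ^ suc m * g (suc m)       ∎)
  where
  open ≤-Reasoning
  regroup : ∀ a P x → a * P * x ≡ P * (a * x)
  regroup = solve-∀
  swap : ∀ P D x → P * (D * x) ≡ D * (P * x)
  swap = solve-∀

bernoulli : ∀ D n → D ^ n * (D + n) ≤ D * suc D ^ n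
bernoulli D zero = ≤-reflexive (base D)
  where
  base : ∀ D → 1 * (D + 0) ≡ D * 1
  base = solve-∀
bernoulli D (suc n) = begin
  D ^ suc n * (D + suc n)                ≡⟨ expand D (D ^ n) n ⟩
  D * (D ^ n * (D + n)) + D ^ n * D      ≤⟨ +-mono-≤ (*-monoʳ-≤ D (bernoulli D n)) (≤-trans (*-monoʳ-≤ (D ^ n) (m≤m+n D n)) (bernoulli D n)) ⟩
  D * (D * suc D ^ n) + D * suc D ^ n    ≡⟨ collect D (suc D ^ n) ⟩
  D * (suc D * suc D ^ n)                ∎
  where
  open ≤-Reasoning
  expand : ∀ D P n → D * P * (D + suc n) ≡ D * (P * (D + n)) + P * D
  expand = solve-∀
  collect : ∀ D Q → D * (D * Q) + D * Q ≡ D * (suc D * Q)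
  collect = solve-∀

doubling : ∀ D .{{_ : NonZero D}} → 2 * D ^ D ≤ suc D ^ D
doubling D = *-cancelˡ-≤ D (≤-trans (≤-reflexive (reorder D (D ^ D))) (bernoulli D D))
  where
  reorder : ∀ D P → D * (2 * P) ≡ P * (D + D)
  reorder = solve-∀

repeated-doubling : ∀ D .{{_ : NonZero D}} e → 2 ^ e * D ^ (D * e) ≤ suc D ^ (D * e)
repeated-doubling D zero rewrite *-zeroʳ D = ≤-refl
repeated-doubling D (suc e) = begin
  2 ^ suc e * D ^ (D * suc e)              ≡⟨ cong (λ x → 2 ^ suc e * D ^ x) (*-suc D e) ⟩
  2 ^ suc e * D ^ (D + D * e)              ≡⟨ cong (2 ^ suc e *_) (^-distribˡ-+-* D D (D * e)) ⟩
  2 * 2 ^ e * (D ^ D * D ^ (D * e))        ≡⟨ regroup (2 ^ e) (D ^ D) (D ^ (D * e)) ⟩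
  (2 * D ^ D) * (2 ^ e * D ^ (D * e))      ≤⟨ *-mono-≤ (doubling D) (repeated-doubling D e) ⟩
  suc D ^ D * suc D ^ (D * e)              ≡⟨ sym (^-distribˡ-+-* (suc D) D (D * e)) ⟩
  suc D ^ (D + D * e)                      ≡⟨ cong (suc D ^_) (sym (*-suc D e)) ⟩
  suc D ^ (D * suc e)                      ∎
  where
  open ≤-Reasoning
  regroup : ∀ a b c → 2 * a * (b * c) ≡ (2 * b) * (a * c)
  regroup = solve-∀

n<2^n : ∀ h → h < 2 ^ h
n<2^n zero    = s≤s z≤n
n<2^n (suc h) = begin-strict
  suc h           <⟨ s≤s (n<2^n h) ⟩
  suc (2 ^ h)     ≤⟨ +-monoˡ-≤ (2 ^ h) (^-monoʳ-≤ 2 {0} {h} z≤n) ⟩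
  2 ^ h + 2 ^ h   ≡⟨ cong (_+_ (2 ^ h)) (sym (+-identityʳ (2 ^ h))) ⟩
  2 ^ suc h       ∎
  where open ≤-Reasoning

quintic<exponential : ∀ h → h * sq (sq h) < 2 ^ (5 * h)
quintic<exponential h = begin-strict
  h * sq (sq h)   ≡⟨ fifth-power h ⟩
  h ^ 5           <⟨ ^-monoˡ-< 5 (n<1+n h) ⟩
  suc h ^ 5       ≤⟨ ^-monoˡ-≤ 5 (n<2^n h) ⟩
  (2 ^ h) ^ 5     ≡⟨ ^-*-assoc 2 h 5 ⟩
  2 ^ (h * 5)     ≡⟨ cong (2 ^_) (*-comm h 5) ⟩
  2 ^ (5 * h)     ∎
  where
  open ≤-Reasoning
  fifth-power : ∀ x → x * (x * x * (x * x)) ≡ x * (x * (x * (x * (x * 1))))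
  fifth-power = solve-∀

-- Since L has polynomial growth, the radii w, w + 4, w + 8, … cannot all see L grow
-- by more than the factor (D+1)/D: after m = 5Dh steps, with h large, the total
-- growth 2^(5h) would exceed the quartic bound.
no-steady-growth : ∀ D .{{_ : NonZero D}} w h → 9 * sq (sq (w + 20 * D)) < h →
  ¬ (suc D ^ (D * (5 * h)) * L w ≤ D ^ (D * (5 * h)) * L (w + 4 * (D * (5 * h))))
no-steady-growth D@(suc _) w h@(suc _) h-large growth = <-irrefl refl (begin-strict
  suc D ^ m                      ≡⟨ sym (*-identityʳ (suc D ^ m)) ⟩
  suc D ^ m * 1                  ≤⟨ *-monoʳ-≤ (suc D ^ m) (L-positive w) ⟩
  suc D ^ m * L w                ≤⟨ growth ⟩
  D ^ m * L s                    ≤⟨ *-monoʳ-≤ (D ^ m) (L-quartic s (≤-trans (s≤s z≤n) (m≤n+m (4 * m) w))) ⟩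
  D ^ m * (9 * sq (sq s))        <⟨ *-monoʳ-< (D ^ m) ⦃ m^n≢0 D m ⦄ quartic-small ⟩
  D ^ m * 2 ^ (5 * h)            ≡⟨ *-comm (D ^ m) (2 ^ (5 * h)) ⟩
  2 ^ (5 * h) * D ^ m            ≤⟨ repeated-doubling D (5 * h) ⟩
  suc D ^ m                      ∎)
  where
  open ≤-Reasoning
  m s c : ℕ
  m = D * (5 * h)
  s = w + 4 * m
  c = w + 20 * D
  s≤ch : s ≤ c * h
  s≤ch = begin
    w + 4 * (D * (5 * h))    ≤⟨ +-monoˡ-≤ (4 * (D * (5 * h))) (m≤m*n w h) ⟩
    w * h + 4 * (D * (5 * h)) ≡⟨ factor w D h ⟩
    c * h                    ∎
    where
    factor : ∀ w D h → w * h + 4 * (D * (5 * h)) ≡ (w + 20 * D) * h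
    factor = solve-∀
  quartic-small : 9 * sq (sq s) < 2 ^ (5 * h)
  quartic-small = begin-strict
    9 * sq (sq s)                      ≤⟨ *-monoʳ-≤ 9 (*-mono-≤ (*-mono-≤ s≤ch s≤ch) (*-mono-≤ s≤ch s≤ch)) ⟩
    9 * sq (sq (c * h))                ≡⟨ split c h ⟩
    9 * sq (sq c) * sq (sq h)          <⟨ *-monoˡ-< (sq (sq h)) h-large ⟩
    h * sq (sq h)                      <⟨ quintic<exponential h ⟩
    2 ^ (5 * h)                        ∎
    where
    split : ∀ x u → 9 * (x * u * (x * u) * (x * u * (x * u))) ≡ 9 * (x * x * (x * x)) * (u * u * (u * u))
    split = solve-∀

slowly-growing-radius : ∀ D .{{_ : NonZero D}} w → Σ ℕ λ y → w ≤ y × D * L (y + 4) ≤ suc D * L y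
slowly-growing-radius D w = choose (slow-step-or-growth D m (λ i → L (w + 4 * i)))
  where
  h m : ℕ
  h = suc (9 * sq (sq (w + 20 * D)))
  m = D * (5 * h)
  choose : (Σ ℕ λ i → i < m × D * L (w + 4 * suc i) ≤ suc D * L (w + 4 * i)) ⊎
           (suc D ^ m * L (w + 4 * 0) ≤ D ^ m * L (w + 4 * m)) →
           Σ ℕ λ y → w ≤ y × D * L (y + 4) ≤ suc D * L y
  choose (inj₁ (i , _ , slow)) = w + 4 * i , m≤m+n w (4 * i) , subst (λ x → D * L x ≤ suc D * L (w + 4 * i)) (step w i) slow
    where
    step : ∀ w i → w + 4 * suc i ≡ w + 4 * i + 4
    step = solve-∀
  choose (inj₂ growth) = ⊥-elim (no-steady-growth D w h (n<1+n _)
    (subst (λ x → suc D ^ m * L x ≤ D ^ m * L (w + 4 * m)) (+-identityʳ w) growth))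

annulus : ℕ → ℕ × ℕ → List ℤ[i]
annulus z (a , b) = filter (λ p → sq (a * z) <? N p) (I (sq (b * z)))

∈-annulus⁻ : ∀ z a b {p} → p ∈ annulus z (a , b) → sq (a * z) < N p × N p ≤ sq (b * z)
∈-annulus⁻ z a b p∈ with ∈-filter⁻ (λ p → sq (a * z) <? N p) {xs = I (sq (b * z))} p∈
... | p∈disc , outside = outside , ∈-I⁻ p∈disc

annulus-unique : ∀ z q → Unique (annulus z q)
annulus-unique z (a , b) = Unique.filter⁺ (λ p → sq (a * z) <? N p) (I-unique (sq (b * z)))

L-annulus : ∀ z a b → L (b * z) ≤ length (annulus z (a , b)) + L (a * z)
L-annulus z a b = begin
  L (b * z)                                          ≤⟨ length-≤-subset (I-unique (sq (b * z))) covered ⟩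
  length (annulus z (a , b) ++ I (sq (a * z)))       ≡⟨ length-++ (annulus z (a , b)) ⟩
  length (annulus z (a , b)) + L (a * z)             ∎
  where
  open ≤-Reasoning
  covered : ∀ {p} → p ∈ I (sq (b * z)) → p ∈ annulus z (a , b) ++ I (sq (a * z))
  covered {p} p∈ with sq (a * z) <? N p
  ... | yes outside = ∈-++⁺ˡ (∈-filter⁺ (λ p → sq (a * z) <? N p) p∈ outside)
  ... | no  inside  = ∈-++⁺ʳ (annulus z (a , b)) (∈-I⁺ p (≮⇒≥ inside))

Nested : List (ℕ × ℕ) → Set
Nested = AllPairs (λ outer inner → proj₂ inner ≤ proj₁ outer)

annuli-unique : ∀ z {bs} → Nested bs → Unique (concatMap (annulus z) bs)
annuli-unique z {bs} nested = Unique.concat⁺ (AllP.map⁺ (All.universal (annulus-unique z) bs))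
                                         (AllPairsP.map⁺ {f = annulus z} (AllPairs.map (λ {outer} {inner} → disjoint {outer} {inner}) nested))
  where
  disjoint : ∀ {outer inner} → proj₂ inner ≤ proj₁ outer → ∀ {p} → ¬ (p ∈ annulus z outer × p ∈ annulus z inner)
  disjoint {a , b} {a′ , b′} b′≤a (p∈outer , p∈inner) =
    <⇒≱ (proj₁ (∈-annulus⁻ z a b p∈outer))
        (≤-trans (proj₂ (∈-annulus⁻ z a′ b′ p∈inner)) (*-mono-≤ (*-monoˡ-≤ z b′≤a) (*-monoˡ-≤ z b′≤a)))

annuli-count : ∀ (A : Subset) z S bs → Nested bs → All (λ q → proj₂ q ≤ S) bs →
  (∀ {q p} → q ∈ bs → p ∈ annulus z q → A p ≡ true) →
  sum (map (λ q → L (proj₂ q * z)) bs) ≤ countIn A (sq (S * z)) + sum (map (λ q → L (proj₁ q * z)) bs)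
annuli-count A z S bs nested within contained =
  ≤-trans (discs-by-annuli bs) (+-monoˡ-≤ _ (length-≤-subset (annuli-unique z nested) in-A))
  where
  discs-by-annuli : ∀ bs → sum (map (λ q → L (proj₂ q * z)) bs)
                         ≤ length (concatMap (annulus z) bs) + sum (map (λ q → L (proj₁ q * z)) bs)
  discs-by-annuli []            = z≤n
  discs-by-annuli ((a , b) ∷ bs) = begin
    L (b * z) + sum (map (λ q → L (proj₂ q * z)) bs)
      ≤⟨ +-mono-≤ (L-annulus z a b) (discs-by-annuli bs) ⟩
    (length (annulus z (a , b)) + L (a * z)) + (length (concatMap (annulus z) bs) + sum (map (λ q → L (proj₁ q * z)) bs))
      ≡⟨ interchange (length (annulus z (a , b))) (L (a * z)) _ _ ⟩
    (length (annulus z (a , b)) + length (concatMap (annulus z) bs)) + (L (a * z) + sum (map (λ q → L (proj₁ q * z)) bs))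
      ≡⟨ cong (_+ _) (sym (length-++ (annulus z (a , b)))) ⟩
    length (concatMap (annulus z) ((a , b) ∷ bs)) + sum (map (λ q → L (proj₁ q * z)) ((a , b) ∷ bs)) ∎
    where
    open ≤-Reasoning
    interchange : ∀ x y u v → (x + y) + (u + v) ≡ (x + u) + (y + v)
    interchange = solve-∀
  in-A : ∀ {p} → p ∈ concatMap (annulus z) bs → p ∈ filter (λ x → T? (A x)) (I (sq (S * z)))
  in-A {p} p∈ with find (∈-concatMap⁻ (annulus z) {xs = bs} p∈)
  ... | (a , b) , q∈ , p∈annulus = ∈-filter⁺ (λ x → T? (A x))
        (∈-I⁺ p (≤-trans (proj₂ (∈-annulus⁻ z a b p∈annulus)) (*-mono-≤ (*-monoˡ-≤ z b≤S) (*-monoˡ-≤ z b≤S))))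
        (Equivalence.from T-≡ (contained q∈ p∈annulus))
    where
    b≤S : b ≤ S
    b≤S = All.lookup within q∈

abstract
  -- The pattern: eight annuli, with radii in units of the scale z, together with
  -- its smallest inner and largest outer radius.  These are abstract so that the
  -- type checker never unfolds their large literals against open terms; only the
  -- verified facts below are exported.
  bands : List (ℕ × ℕ)
  bands = (250000 , 500000) ∷ (88389 , 176776) ∷ (17242 , 17334) ∷ (8668 , 16413) ∷
          (8207 , 8620) ∷ (6096 , 6128) ∷ (3219 , 5802) ∷ (3065 , 3201) ∷ []

  rIn rOut : ℕ
  rIn  = 3065
  rOut = 500000

InBand : ℕ → ℕ → ℕ × ℕ → Set
InBand z x (a , b) = sq (a * z) < x × x ≤ sq (b * z)

-- Both predicates are decidable, so the set and the verification below are computable.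
inBand? : ∀ z x q → Dec (InBand z x q)
inBand? z x (a , b) = (sq (a * z) <? x) ×-dec (x ≤? sq (b * z))

-- Apart u i j: at any common scale, no x in annulus i has x·u in annulus j
-- (the interval for j lies entirely below or entirely above u times the one for i).
Apart : ℕ → ℕ × ℕ → ℕ × ℕ → Set
Apart u (aᵢ , bᵢ) (aⱼ , bⱼ) = sq bⱼ ≤ sq aᵢ * u ⊎ sq bᵢ * u ≤ sq aⱼ

apart? : ∀ u i j → Dec (Apart u i j)
apart? u (aᵢ , bᵢ) (aⱼ , bⱼ) = (sq bⱼ ≤? sq aᵢ * u) ⊎-dec (sq bᵢ * u ≤? sq aⱼ)

apart-sound : ∀ {u} z x i j → 1 ≤ u → Apart u i j → InBand z x i → InBand z (x * u) j → ⊥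
apart-sound {u} z x (aᵢ , bᵢ) (aⱼ , bⱼ) 1≤u (inj₁ below) (loᵢ , _) (_ , hiⱼ) = <-irrefl refl (begin-strict
  x * u                   ≤⟨ hiⱼ ⟩
  sq (bⱼ * z)             ≡⟨ sq-* bⱼ z ⟩
  sq bⱼ * sq z            ≤⟨ *-monoˡ-≤ (sq z) below ⟩
  sq aᵢ * u * sq z        ≡⟨ xy∙z≈xz∙y (sq aᵢ) u (sq z) ⟩
  sq aᵢ * sq z * u        ≡⟨ cong (_* u) (sym (sq-* aᵢ z)) ⟩
  sq (aᵢ * z) * u         <⟨ *-monoˡ-< u ⦃ >-nonZero 1≤u ⦄ loᵢ ⟩
  x * u                   ∎)
  where
  open ≤-Reasoning
apart-sound {u} z x (aᵢ , bᵢ) (aⱼ , bⱼ) _ (inj₂ above) (_ , hiᵢ) (loⱼ , _) = <-irrefl refl (begin-strict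
  x * u                   ≤⟨ *-monoˡ-≤ u hiᵢ ⟩
  sq (bᵢ * z) * u         ≡⟨ cong (_* u) (sq-* bᵢ z) ⟩
  sq bᵢ * sq z * u        ≡⟨ xy∙z≈xz∙y (sq bᵢ) (sq z) u ⟩
  sq bᵢ * u * sq z        ≤⟨ *-monoˡ-≤ (sq z) above ⟩
  sq aⱼ * sq z            ≡⟨ sym (sq-* aⱼ z) ⟩
  sq (aⱼ * z)             <⟨ loⱼ ⟩
  x * u                   ∎)
  where
  open ≤-Reasoning

-- A progression x, x·t, x·t² through the annuli i, j, k is excluded by one of its three ratios.
Excluded : ℕ → ℕ × ℕ → ℕ × ℕ → ℕ × ℕ → Set
Excluded t i j k = Apart t i j ⊎ Apart t j k ⊎ Apart (t * t) i k

ExcludedFor : ℕ → Set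
ExcludedFor t = 2 ≤ t → All (λ i → All (λ j → All (λ k → Excluded t i j k) bands) bands) bands

inner-mass outer-mass : ℕ
inner-mass = sum (map (λ q → sq (proj₁ q)) bands)
outer-mass = sum (map (λ q → sq (proj₂ q)) bands)

abstract
  small-ratios-excluded : All (λ a → All (λ b → ExcludedFor (sq a + sq b)) (upTo 13)) (upTo 13)
  small-ratios-excluded = from-yes (all? (λ a → all? (λ b → excludedFor? (sq a + sq b)) (upTo 13)) (upTo 13))
    where
    excludedFor? : ∀ t → Dec (ExcludedFor t)
    excludedFor? t = (2 ≤? t) →-dec all? (λ i → all? (λ j → all? (λ k →
                       apart? t i j ⊎-dec apart? t j k ⊎-dec apart? (t * t) i k) bands) bands) bands

  bands-nested : Nested bands
  bands-nested = from-yes (allPairs? (λ outer inner → proj₂ inner ≤? proj₁ outer) bands)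

  bands-within : All (λ q → rIn ≤ proj₁ q × proj₂ q ≤ rOut) bands
  bands-within = from-yes (all? (λ q → (rIn ≤? proj₁ q) ×-dec (proj₂ q ≤? rOut)) bands)

  rIn-positive : 1 ≤ rIn
  rIn-positive = s≤s z≤n

  rIn≤rOut : rIn ≤ rOut
  rIn≤rOut = from-yes (rIn ≤? rOut)

  narrow-span : sq rOut ≤ sq rIn * sq 169
  narrow-span = from-yes (sq rOut ≤? sq rIn * sq 169)

  density-margin : 844662 * sq rOut + 1000000 * inner-mass ≤ 1000000 * outer-mass
  density-margin = from-yes (844662 * sq rOut + 1000000 * inner-mass ≤? 1000000 * outer-mass)

band-range : ∀ w {x q} → q ∈ bands → InBand w x q → sq (rIn * w) < x × x ≤ sq (rOut * w)
band-range w {q = a , b} q∈ (lo , hi) =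
  ≤-<-trans (sq-mono (*-monoˡ-≤ w (proj₁ (All.lookup bands-within q∈)))) lo ,
  ≤-trans hi (sq-mono (*-monoˡ-≤ w (proj₂ (All.lookup bands-within q∈))))

large-ratio-excluded : ∀ z x t → 169 ≤ t → Any (InBand z x) bands → Any (InBand z (x * t * t)) bands → ⊥
large-ratio-excluded z x t 169≤t inᵢ inₖ with find inᵢ | find inₖ
... | i , i∈ , xᵢ | k , k∈ , xₖ = <-irrefl refl (begin-strict
  sq (rIn * z) * sq 169    <⟨ *-monoˡ-< (sq 169) (proj₁ (band-range z i∈ xᵢ)) ⟩
  x * sq 169               ≤⟨ *-monoʳ-≤ x (sq-mono 169≤t) ⟩
  x * (t * t)              ≡⟨ sym (*-assoc x t t) ⟩
  x * t * t                ≤⟨ proj₂ (band-range z k∈ xₖ) ⟩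
  sq (rOut * z)            ≡⟨ sq-* rOut z ⟩
  sq rOut * sq z           ≤⟨ *-monoˡ-≤ (sq z) narrow-span ⟩
  sq rIn * sq 169 * sq z   ≡⟨ xy∙z≈xz∙y (sq rIn) (sq 169) (sq z) ⟩
  sq rIn * sq z * sq 169   ≡⟨ cong (_* sq 169) (sym (sq-* rIn z)) ⟩
  sq (rIn * z) * sq 169    ∎)
  where
  open ≤-Reasoning

excluded-ratio-free : ∀ z x t → 1 ≤ t →
  (∀ {i j k} → i ∈ bands → j ∈ bands → k ∈ bands → Excluded t i j k) →
  Any (InBand z x) bands → Any (InBand z (x * t)) bands → Any (InBand z (x * t * t)) bands → ⊥
excluded-ratio-free z x t 1≤t excluded inᵢ inⱼ inₖ with find inᵢ | find inⱼ | find inₖ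
... | i , i∈ , xᵢ | j , j∈ , xⱼ | k , k∈ , xₖ with excluded i∈ j∈ k∈
...   | inj₁ apartᵢⱼ        = apart-sound z x i j 1≤t apartᵢⱼ xᵢ xⱼ
...   | inj₂ (inj₁ apartⱼₖ) = apart-sound z (x * t) j k 1≤t apartⱼₖ xⱼ xₖ
...   | inj₂ (inj₂ apartᵢₖ) = apart-sound z x i k (*-mono-≤ 1≤t 1≤t) apartᵢₖ xᵢ (subst (λ y → InBand z y k) (*-assoc x t t) xₖ)

-- Within a single scale z there is no progression x, x·t, x·t² of norms of the
-- pattern, for any t = a² + b² ≥ 2: small ratios are excluded by the table,
-- large ones by the narrow span.
single-scale-free : ∀ z x a b → 2 ≤ sq a + sq b →
  let t = sq a + sq b in
  Any (InBand z x) bands → Any (InBand z (x * t)) bands → Any (InBand z (x * t * t)) bands → ⊥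
single-scale-free z x a b 2≤t with a <? 13 | b <? 13
... | yes a<13 | yes b<13 = excluded-ratio-free z x _ (≤-trans (s≤s z≤n) 2≤t) (λ i∈ j∈ k∈ →
  All.lookup (All.lookup (All.lookup (All.lookup (All.lookup small-ratios-excluded (∈-upTo⁺ a<13)) (∈-upTo⁺ b<13) 2≤t) i∈) j∈) k∈)
... | no a≮13 | _ = λ inᵢ _ inₖ →
  large-ratio-excluded z x _ (≤-trans (sq-mono (≮⇒≥ a≮13)) (m≤m+n (sq a) (sq b))) inᵢ inₖ
... | yes _ | no b≮13 = λ inᵢ _ inₖ →
  large-ratio-excluded z x _ (≤-trans (sq-mono (≮⇒≥ b≮13)) (m≤n+m (sq b) (sq a))) inᵢ inₖ

module Lacunary (z : ℕ → ℕ) (z-positive : ∀ j → 1 ≤ z j) (j≤z : ∀ j → j ≤ z j)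
                (lacunary : ∀ j → sq (sq (rOut * z j)) ≤ sq (rIn * z (suc j))) where

  Lo Hi : ℕ → ℕ
  Lo j = sq (rIn * z j)
  Hi j = sq (rOut * z j)

  InScale : ℕ → ℕ → Set
  InScale j x = Any (InBand (z j) x) bands

  scale-range : ∀ {j x} → InScale j x → Lo j < x × x ≤ Hi j
  scale-range {j} x∈ with find x∈
  ... | _ , q∈ , inBand = band-range (z j) q∈ inBand

  Lo-step : ∀ j → Lo j ≤ Lo (suc j)
  Lo-step j = ≤-trans (sq-mono (*-monoˡ-≤ (z j) rIn≤rOut)) (≤-trans (n≤sq (Hi j)) (lacunary j))

  Lo-mono : ∀ {j j′} → j ≤ j′ → Lo j ≤ Lo j′
  Lo-mono {j} {j′} j≤j′ = subst (λ i → Lo j ≤ Lo i) (m+[n∸m]≡n j≤j′) (climb (j′ ∸ j))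
    where
    climb : ∀ d → Lo j ≤ Lo (j + d)
    climb zero    = ≤-reflexive (cong Lo (sym (+-identityʳ j)))
    climb (suc d) = ≤-trans (climb d) (subst (λ i → Lo (j + d) ≤ Lo i) (sym (+-suc j d)) (Lo-step (j + d)))

  Hi²<later : ∀ {j j′} → j < j′ → sq (Hi j) ≤ Lo j′
  Hi²<later {j} j<j′ = ≤-trans (lacunary j) (Lo-mono j<j′)

  scale-order : ∀ {j j′ x y} → InScale j x → InScale j′ y → x ≤ y → j ≤ j′
  scale-order {j} {j′} {x} {y} x∈ y∈ x≤y with j ≤? j′
  ... | yes j≤j′ = j≤j′
  ... | no  j≰j′ = ⊥-elim (<-irrefl refl (begin-strict
    y            ≤⟨ proj₂ (scale-range y∈) ⟩
    Hi j′        ≤⟨ n≤sq (Hi j′) ⟩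
    sq (Hi j′)   ≤⟨ Hi²<later (≰⇒> j≰j′) ⟩
    Lo j         <⟨ proj₁ (scale-range x∈) ⟩
    x            ≤⟨ x≤y ⟩
    y            ∎))
    where open ≤-Reasoning

  -- A progression cannot jump to a later scale between its second and third term:
  -- (x·t)·t ≤ (x·t)² would then have to exceed the square of a norm of the earlier scale.
  late-jump-free : ∀ {j j′ x t} → 1 ≤ x → j < j′ → InScale j (x * t) → InScale j′ (x * t * t) → ⊥
  late-jump-free {j} {j′} {x} {t} 1≤x j<j′ xt∈ xtt∈ = <-irrefl refl (begin-strict
    x * t * t           ≤⟨ *-monoʳ-≤ (x * t) (m≤n*m t x ⦃ >-nonZero 1≤x ⦄) ⟩
    x * t * (x * t)     ≤⟨ *-mono-≤ (proj₂ (scale-range xt∈)) (proj₂ (scale-range xt∈)) ⟩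
    sq (Hi j)           ≤⟨ Hi²<later j<j′ ⟩
    Lo j′               <⟨ proj₁ (scale-range xtt∈) ⟩
    x * t * t           ∎)
    where open ≤-Reasoning

  -- Nor can it jump between its first and second term: the last two terms share a
  -- scale, which bounds t by rOut², and then x·t stays below that scale.
  early-jump-free : ∀ {j j′ x t} → 1 ≤ t → j < j′ → InScale j x → InScale j′ (x * t) → InScale j′ (x * t * t) → ⊥
  early-jump-free {j} {j′} {x} {t} 1≤t j<j′ x∈ xt∈ xtt∈ = <-irrefl refl (begin-strict
    x * t             ≤⟨ *-monoˡ-≤ t (proj₂ (scale-range x∈)) ⟩
    Hi j * t          ≤⟨ *-monoʳ-≤ (Hi j) (<⇒≤ t<rOut²) ⟩
    Hi j * sq rOut    ≤⟨ *-monoʳ-≤ (Hi j) rOut²≤Hi ⟩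
    sq (Hi j)         ≤⟨ Hi²<later j<j′ ⟩
    Lo j′             <⟨ proj₁ (scale-range xt∈) ⟩
    x * t             ∎)
    where
    open ≤-Reasoning
    Z : ℕ
    Z = sq (z j′)
    rOut²≤Hi : sq rOut ≤ Hi j
    rOut²≤Hi = sq-mono (≤-trans (≤-reflexive (sym (*-identityʳ rOut))) (*-monoʳ-≤ rOut (z-positive j)))
    same-scale : sq rIn * t * Z < sq rOut * Z
    same-scale = begin-strict
      sq rIn * t * Z      ≡⟨ xy∙z≈xz∙y (sq rIn) t Z ⟩
      sq rIn * Z * t      ≡⟨ cong (_* t) (sym (sq-* rIn (z j′))) ⟩
      Lo j′ * t           <⟨ *-monoˡ-< t ⦃ >-nonZero 1≤t ⦄ (proj₁ (scale-range xt∈)) ⟩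
      x * t * t           ≤⟨ proj₂ (scale-range xtt∈) ⟩
      Hi j′               ≡⟨ sq-* rOut (z j′) ⟩
      sq rOut * Z         ∎
    t<rOut² : t < sq rOut
    t<rOut² = ≤-<-trans (m≤n*m t (sq rIn) ⦃ >-nonZero (sq-mono rIn-positive) ⦄)
                        (*-cancelʳ-< Z (sq rIn * t) (sq rOut) same-scale)

  -- Three norms x ≥ 1, x·t, x·t² with t = a² + b² ≥ 2 never all lie in the pattern:
  -- compare their scales j₁ ≤ j₂ ≤ j₃.
  progression-free : ∀ {j₁ j₂ j₃} x a b → 1 ≤ x → 2 ≤ sq a + sq b → let t = sq a + sq b in
    InScale j₁ x → InScale j₂ (x * t) → InScale j₃ (x * t * t) → ⊥
  progression-free x a b 1≤x 2≤t x∈ xt∈ xtt∈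
    with m≤n⇒m<n∨m≡n (scale-order xt∈ xtt∈ (m≤m*n (x * _) _ ⦃ >-nonZero (<⇒≤ 2≤t) ⦄))
  ... | inj₁ j₂<j₃ = late-jump-free 1≤x j₂<j₃ xt∈ xtt∈
  ... | inj₂ refl with m≤n⇒m<n∨m≡n (scale-order x∈ xt∈ (m≤m*n x _ ⦃ >-nonZero (<⇒≤ 2≤t) ⦄))
  ...   | inj₁ j₁<j₂ = early-jump-free (<⇒≤ 2≤t) j₁<j₂ x∈ xt∈ xtt∈
  ...   | inj₂ refl  = single-scale-free (z _) x a b 2≤t x∈ xt∈ xtt∈

  -- The set: Gaussian integers whose norm lies in the pattern at some scale.
  -- Since z j ≥ j, only the scales j ≤ N p have to be searched.
  inPattern? : ∀ x → Dec (Any (λ j → InScale j x) (upTo (suc x)))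
  inPattern? x = any? (λ j → any? (inBand? (z j) x) bands) (upTo (suc x))

  patternSet : Subset
  patternSet p = isYes (inPattern? (N p))

  patternSet-sound : ∀ {p} → patternSet p ≡ true → Σ ℕ λ j → InScale j (N p)
  patternSet-sound {p} p∈ = scale-witness (toWitness {a? = inPattern? (N p)} (Equivalence.from T-≡ p∈))
    where
    scale-witness : ∀ {x} → Any (λ j → InScale j x) (upTo (suc x)) → Σ ℕ λ j → InScale j x
    scale-witness found = let (j , _ , x∈) = find found in j , x∈

  patternSet-complete : ∀ j {q p} → q ∈ bands → InBand (z j) (N p) q → patternSet p ≡ true
  patternSet-complete j {q} {p} q∈ inBand =
    Equivalence.to T-≡ (fromWitness {a? = inPattern? (N p)} (lose (∈-upTo⁺ (s≤s j≤Np)) (lose q∈ inBand)))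
    where
    j≤Np : j ≤ N p
    j≤Np = ≤-trans (j≤z j) (≤-trans (m≤n*m (z j) rIn ⦃ >-nonZero rIn-positive ⦄)
             (≤-trans (n≤sq (rIn * z j)) (<⇒≤ (proj₁ (band-range (z j) q∈ inBand)))))

  -- The norm is multiplicative, so a progression n, n·r, n·r² in the set gives a
  -- progression of norms N n, N n·N r, N n·N r² in the pattern.
  patternSet-GP-free : NoGP3 patternSet
  patternSet-GP-free n r@(ra , rb) n≢0 r≢0 r-nonunit n∈ nr∈ nrr∈ =
    progression-free (N n) (∣ ra ∣) (∣ rb ∣) (N-nonzero n n≢0) (N-nonunit r r≢0 r-nonunit)
      (proj₂ (patternSet-sound {n} n∈))
      (subst (InScale _) (N-* n r) (proj₂ (patternSet-sound {n *ᵍ r} nr∈)))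
      (subst (InScale _) (trans (N-* (n *ᵍ r) r) (cong (_* N r) (N-* n r))) (proj₂ (patternSet-sound {(n *ᵍ r) *ᵍ r} nrr∈)))

sum-map-mono : ∀ {A : Set} (f g : A → ℕ) xs → (∀ {x} → x ∈ xs → f x ≤ g x) → sum (map f xs) ≤ sum (map g xs)
sum-map-mono f g []       _      = z≤n
sum-map-mono f g (x ∷ xs) f≤g = +-mono-≤ (f≤g (here refl)) (sum-map-mono f g xs (λ x∈ → f≤g (there x∈)))

sum-map-*ʳ : ∀ {A : Set} (f : A → ℕ) c xs → sum (map (λ x → f x * c) xs) ≡ sum (map f xs) * c
sum-map-*ʳ f c []       = refl
sum-map-*ʳ f c (x ∷ xs) = trans (cong (_+_ (f x * c)) (sum-map-*ʳ f c xs)) (sym (*-distribʳ-+ c (f x) (sum (map f xs))))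

-- With K = k + 1, target density p/q, S = rOut², masses
-- SA = Σ a², SB = Σ b², a count cnt of the set among the II points of norm ≤ n,
-- and disc counts P ≤ Q satisfying
--   S·P ≤ II ≤ S·Q,   SB·P ≤ cnt + SA·Q,   (1 + K·C)·Q ≤ (2 + K·C)·P  (C = p·S + q·SA),
-- the margin p·S + q·SA ≤ q·SB yields cnt/II ≥ p/q − 1/K.
ratio-from-estimates : ∀ p q K SA SB S cnt P Q II →
  p * S + q * SA ≤ q * SB →
  SB * P ≤ cnt + SA * Q →
  suc (K * (p * S + q * SA)) * Q ≤ suc (suc (K * (p * S + q * SA))) * P →
  P ≤ Q → S * P ≤ II → II ≤ S * Q → 1 ≤ q → 1 ≤ S →
  p * K * II ≤ cnt * q * K + q * II
ratio-from-estimates p q K SA SB S cnt P Q II margin count slow P≤Q II-lower II-upper 1≤q 1≤S = begin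
  p * K * II                 ≤⟨ *-monoʳ-≤ (p * K) II-upper ⟩
  p * K * (S * Q)            ≤⟨ +-cancelʳ-≤ (q * K * SA * Q) _ _ main ⟩
  q * K * cnt + P            ≤⟨ +-monoʳ-≤ (q * K * cnt) P≤qSP ⟩
  q * K * cnt + q * (S * P)  ≤⟨ +-monoʳ-≤ (q * K * cnt) (*-monoʳ-≤ q II-lower) ⟩
  q * K * cnt + q * II       ≡⟨ cong (_+ q * II) (reorder q K cnt) ⟩
  cnt * q * K + q * II       ∎
  where
  open ≤-Reasoning
  C : ℕ
  C = p * S + q * SA
  reorder : ∀ q K c → q * K * c ≡ c * q * K
  reorder = solve-∀
  slow′ : K * C * Q ≤ K * C * P + P
  slow′ = +-cancelˡ-≤ Q _ _ (begin
    Q + K * C * Q             ≡⟨⟩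
    suc (K * C) * Q           ≤⟨ slow ⟩
    suc (suc (K * C)) * P     ≡⟨ expand (K * C) P ⟩
    P + (K * C * P + P)       ≤⟨ +-monoˡ-≤ (K * C * P + P) P≤Q ⟩
    Q + (K * C * P + P)       ∎)
    where
    expand : ∀ x P → suc (suc x) * P ≡ P + (x * P + P)
    expand = solve-∀
  counted : K * P * C ≤ q * K * cnt + q * K * SA * Q
  counted = begin
    K * P * C                    ≤⟨ *-monoʳ-≤ (K * P) margin ⟩
    K * P * (q * SB)             ≡⟨ regroup K P q SB ⟩
    q * K * (SB * P)             ≤⟨ *-monoʳ-≤ (q * K) count ⟩
    q * K * (cnt + SA * Q)       ≡⟨ distribute q K cnt SA Q ⟩
    q * K * cnt + q * K * SA * Q ∎
    where
    regroup : ∀ K P q SB → K * P * (q * SB) ≡ q * K * (SB * P)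
    regroup = solve-∀
    distribute : ∀ q K cnt SA Q → q * K * (cnt + SA * Q) ≡ q * K * cnt + q * K * SA * Q
    distribute = solve-∀
  main : p * K * (S * Q) + q * K * SA * Q ≤ q * K * cnt + P + q * K * SA * Q
  main = begin
    p * K * (S * Q) + q * K * SA * Q     ≡⟨ collect p K S Q q SA ⟩
    K * C * Q                            ≤⟨ slow′ ⟩
    K * C * P + P                        ≡⟨ cong (_+ P) (swap K C P) ⟩
    K * P * C + P                        ≤⟨ +-monoˡ-≤ P counted ⟩
    q * K * cnt + q * K * SA * Q + P     ≡⟨ rotate (q * K * cnt) (q * K * SA * Q) P ⟩
    q * K * cnt + P + q * K * SA * Q     ∎
    where
    collect : ∀ p K S Q q SA → p * K * (S * Q) + q * K * SA * Q ≡ K * (p * S + q * SA) * Q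
    collect = solve-∀
    swap : ∀ K C P → K * C * P ≡ K * P * C
    swap = solve-∀
    rotate : ∀ a b c → a + b + c ≡ a + c + b
    rotate = solve-∀
  P≤qSP : P ≤ q * (S * P)
  P≤qSP = begin
    P            ≡⟨ sym (*-identityˡ P) ⟩
    1 * P        ≤⟨ *-monoˡ-≤ P (*-mono-≤ 1≤q 1≤S) ⟩
    q * S * P    ≡⟨ *-assoc q S P ⟩
    q * (S * P)  ∎

-- Radii along which L grows slowly, spaced so that the scales z j = radius j + 2
-- form a lacunary sequence.
module Scales (D : ℕ) ⦃ _ : NonZero D ⦄ where

  radius : ℕ → ℕ
  radius zero    = proj₁ (slowly-growing-radius D 0)
  radius (suc j) = proj₁ (slowly-growing-radius D (sq (rOut * (radius j + 2))))

  scale : ℕ → ℕ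
  scale j = radius j + 2

  radius-slow : ∀ j → D * L (radius j + 4) ≤ suc D * L (radius j)
  radius-slow zero    = proj₂ (proj₂ (slowly-growing-radius D 0))
  radius-slow (suc j) = proj₂ (proj₂ (slowly-growing-radius D (sq (rOut * scale j))))

  scale-positive : ∀ j → 1 ≤ scale j
  scale-positive j = ≤-trans (s≤s z≤n) (m≤n+m 2 (radius j))

  next-radius : ∀ j → sq (rOut * scale j) ≤ radius (suc j)
  next-radius j = proj₁ (proj₂ (slowly-growing-radius D (sq (rOut * scale j))))

  radius≤scale : ∀ j → radius j ≤ scale j
  radius≤scale j = m≤m+n (radius j) 2

  ≤rOut* : ∀ x → x ≤ rOut * x
  ≤rOut* x = m≤n*m x rOut ⦃ >-nonZero (≤-trans rIn-positive rIn≤rOut) ⦄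

  j≤scale : ∀ j → j ≤ scale j
  j≤scale zero    = z≤n
  j≤scale (suc j) = begin
    suc j                   ≤⟨ s≤s (j≤scale j) ⟩
    suc (scale j)           ≤⟨ s≤s (≤-trans (n≤sq (scale j)) (≤-trans (sq-mono (≤rOut* (scale j))) (next-radius j))) ⟩
    suc (radius (suc j))    ≤⟨ n≤1+n _ ⟩
    2 + radius (suc j)      ≡⟨ +-comm 2 (radius (suc j)) ⟩
    scale (suc j)           ∎
    where open ≤-Reasoning

  scale-lacunary : ∀ j → sq (sq (rOut * scale j)) ≤ sq (rIn * scale (suc j))
  scale-lacunary j = sq-mono (≤-trans (next-radius j) (≤-trans (radius≤scale (suc j))
                       (m≤n*m (scale (suc j)) rIn ⦃ >-nonZero rIn-positive ⦄)))

growth-parameter : ℕ → ℕ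
growth-parameter k = suc (suc k * (844662 * sq rOut + 1000000 * inner-mass))

module Construction (k : ℕ) where
  open Scales (growth-parameter k) public
  open Lacunary scale scale-positive j≤scale scale-lacunary public

  -- Counting the set in the disc of radius rOut·z through its annuli at scale
  -- z = y + 2, and comparing each disc count with L y and L (y + 4).
  count-lower : ∀ j → let y = radius j ; z = scale j in
    outer-mass * L y ≤ countIn patternSet (sq (rOut * z)) + inner-mass * L (y + 4)
  count-lower j = begin
    outer-mass * L y                                       ≡⟨ sym (sum-map-*ʳ (λ q → sq (proj₂ q)) (L y) bands) ⟩
    sum (map (λ q → sq (proj₂ q) * L y) bands)             ≤⟨ sum-map-mono _ _ bands (λ {q} _ → L-dilate-lower (proj₂ q) y) ⟩
    sum (map (λ q → L (proj₂ q * z)) bands)                ≤⟨ annuli-count patternSet z rOut bands bands-nested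
                                                                (All.map proj₂ bands-within) contained ⟩
    cnt + sum (map (λ q → L (proj₁ q * z)) bands)          ≤⟨ +-monoʳ-≤ cnt (sum-map-mono _ _ bands inner-upper) ⟩
    cnt + sum (map (λ q → sq (proj₁ q) * L (z + 2)) bands) ≡⟨ cong (_+_ cnt) (sum-map-*ʳ (λ q → sq (proj₁ q)) (L (z + 2)) bands) ⟩
    cnt + inner-mass * L (z + 2)                           ≡⟨ cong (λ r → cnt + inner-mass * L r) (+-assoc y 2 2) ⟩
    cnt + inner-mass * L (y + 4)                           ∎
    where
    open ≤-Reasoning
    y z cnt : ℕ
    y = radius j
    z = scale j
    cnt = countIn patternSet (sq (rOut * z))
    contained : ∀ {q p} → q ∈ bands → p ∈ annulus z q → patternSet p ≡ true
    contained {a , b} {p} q∈ p∈ = patternSet-complete j {p = p} q∈ (∈-annulus⁻ z a b p∈)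
    inner-upper : ∀ {q} → q ∈ bands → L (proj₁ q * z) ≤ sq (proj₁ q) * L (z + 2)
    inner-upper {q} q∈ = L-dilate-upper (proj₁ q) z (≤-trans rIn-positive (proj₁ (All.lookup bands-within q∈)))

  dense : (N₀ : ℕ) → Σ ℕ (λ n → N₀ ≤ n × RatioAtLeast patternSet n 844662 1000000 k)
  dense N₀ = sq (rOut * z) , N₀≤n ,
    ratio-from-estimates 844662 1000000 (suc k) inner-mass outer-mass (sq rOut) _ (L y) (L (y + 4)) _
      density-margin (count-lower N₀) (radius-slow N₀) (L-mono (m≤m+n y 4))
      (L-dilate-lower rOut y) disc-upper (s≤s z≤n) (sq-mono 1≤rOut)
    where
    y z : ℕ
    y = radius N₀
    z = scale N₀
    1≤rOut : 1 ≤ rOut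
    1≤rOut = ≤-trans rIn-positive rIn≤rOut
    N₀≤n : N₀ ≤ sq (rOut * z)
    N₀≤n = ≤-trans (j≤scale N₀) (≤-trans (≤rOut* z) (n≤sq (rOut * z)))
    disc-upper : L (rOut * z) ≤ sq rOut * L (y + 4)
    disc-upper = subst (λ r → L (rOut * z) ≤ sq rOut * L r) (+-assoc y 2 2) (L-dilate-upper rOut z 1≤rOut)

theorem4p3 : (k : ℕ) → Σ Subset (λ A → NoGP3 A ×
               ((N₀ : ℕ) → Σ ℕ (λ n → N₀ ≤ n × RatioAtLeast A n 844662 1000000 k)))
theorem4p3 k = patternSet , patternSet-GP-free , dense
  where open Construction k
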